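{- Let $d,n$ be positive integers with $2d\mid n$. Every $d$-Galvin family $\mathcal F$ over $[n]$ satisfies $|\mathcal F|\ge \frac{d^2}{2}$.
   Context: A set $S$ is balanced on a set $A$ if $|S\cap A| = |S|/2$. Given $2d\mid n$, a family $\mathcal F\subseteq\binom{[n]}{n/d}$ is $d$-Galvin if for every $A\in\binom{[n]}{n/2}$ there exist $d$ sets $S_1,\dots,S_d\in\mathcal F$ that form a partition of $[n]$ and such that each $S_i$ is balanced on $A$, i.e. $|S_i\cap A| = \frac{n}{2d}$. -}

module Defs where

open import Data.Nat using (ℕ; _*_)
open import Data.Fin using (Fin)
open import Data.Fin.Subset using (Subset; ∣_∣; _∩_; _∈_)
open import Data.List using (List)
import Data.List.Membership.Propositional as LM
open import Data.Product using (Σ; _×_; ∃-syntax)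
open import Relation.Binary.PropositionalEquality using (_≡_)

-- S is balanced on A : |S ∩ A| = |S| / 2  (stated division-free as 2|S∩A| = |S|)
Balanced : ∀ {n} → Subset n → Subset n → Set
Balanced S A = 2 * ∣ S ∩ A ∣ ≡ ∣ S ∣

IsPartition : ∀ {n} d → (Fin d → Subset n) → Set
IsPartition {n} d S = (x : Fin n) → Σ (Fin d) λ i → (x ∈ S i) × ((j : Fin d) → x ∈ S j → j ≡ i)

-- A family F ⊆ ([n] choose n/d) (given as a list of subsets; |F| is its length,
-- and it is required duplicate-free in the statement) is d-Galvin.
IsGalvin : ∀ {n} d → List (Subset n) → Set
IsGalvin {n} d F =
  ((S : Subset n) → S LM.∈ F → ∣ S ∣ * d ≡ n) ×
  ((A : Subset n) → 2 * ∣ A ∣ ≡ n →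
     ∃[ S ] (((i : Fin d) → S i LM.∈ F) × IsPartition d S × ((i : Fin d) → Balanced (S i) A)))

module Submission where

-- Fix a point x and let star x F be the union of the members of F containing x.
-- If |star x F| < n/2, enlarge it to a set A of size exactly n/2.  The Galvin property
-- yields a partition of [n] into members balanced on A; the block S through x satisfies
-- S ⊆ star x F ⊆ A, so S ∩ A = S, and balancedness 2|S ∩ A| = |S| forces S = ∅,
-- contradicting x ∈ S.  Hence |star x F| ≥ n/2, and since star x F is a union of
-- deg x F sets of size n/d, every point has degree deg x F ≥ d/2.  Double counting the
-- incidences (x, S) with x ∈ S ∈ F gives  n · d/2 ≤ Σₓ deg x F = |F| · n/d,
-- i.e. d² ≤ 2|F|.

open import Defs
open import Data.Nat using (ℕ; _*_; _≤_; NonZero)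
open import Data.Nat.Divisibility using (_∣_)
open import Data.Fin.Subset using (Subset)
open import Data.List using (List; length)
open import Data.List.Relation.Unary.Unique.Propositional using (Unique)

open import Data.Nat using (zero; suc; _+_; z≤n; s≤s)
open import Data.Nat.Properties
open import Data.Nat.Divisibility using (divides)
open import Data.Nat.ListAction using (sum)
open import Data.Nat.Solver using (module +-*-Solver)
open import Algebra.Properties.CommutativeSemigroup +-commutativeSemigroup using (interchange)
open import Data.Bool using (Bool; true; false; if_then_else_)
open import Data.Fin using (Fin; zero; suc)
open import Data.Fin.Subset using (_∪_; _∩_; ⊥; ⁅_⁆; _⊆_; _∈_; ∣_∣)
open import Data.Fin.Subset.Properties
  using (p⊆q⇒∣p∣≤∣q∣; p⊆p∪q; q⊆p∪q; ⊆-trans; out⊆; s⊆s; x∈p∩q⁺; ∣p∣≤n; ∣⊥∣≡0; ∣⁅x⁆∣≡1; x∈⁅y⁆⇒x≡y)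
open import Data.Vec using ([]; _∷_; lookup)
open import Data.Vec.Properties using ([]=⇒lookup)
open import Data.List using ([]; _∷_; map)
open import Data.List.Relation.Unary.Any using (here; there)
import Data.List.Membership.Propositional as LM
open import Data.Product using (_×_; _,_; ∃-syntax)
open import Relation.Nullary using (yes; no; contradiction)
open import Relation.Binary.PropositionalEquality

sumFin : ∀ {n} → (Fin n → ℕ) → ℕ
sumFin {zero} f = 0
sumFin {suc n} f = f zero + sumFin (λ x → f (suc x))

sumFin-zero : ∀ n → sumFin {n} (λ _ → 0) ≡ 0
sumFin-zero zero = refl
sumFin-zero (suc n) = sumFin-zero n

sumFin-+ : ∀ {n} (f g : Fin n → ℕ) → sumFin (λ x → f x + g x) ≡ sumFin f + sumFin g
sumFin-+ {zero} f g = refl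
sumFin-+ {suc n} f g = begin
    f zero + g zero + sumFin (λ x → f (suc x) + g (suc x))
      ≡⟨ cong (f zero + g zero +_) (sumFin-+ (λ x → f (suc x)) (λ x → g (suc x))) ⟩
    f zero + g zero + (sumFin (λ x → f (suc x)) + sumFin (λ x → g (suc x)))
      ≡⟨ interchange (f zero) (g zero) _ _ ⟩
    f zero + sumFin (λ x → f (suc x)) + (g zero + sumFin (λ x → g (suc x))) ∎
  where open ≡-Reasoning

sumFin-*ˡ : ∀ {n} k (f : Fin n → ℕ) → sumFin (λ x → k * f x) ≡ k * sumFin f
sumFin-*ˡ {zero} k f = sym (*-zeroʳ k)
sumFin-*ˡ {suc n} k f = trans (cong (k * f zero +_) (sumFin-*ˡ k (λ x → f (suc x))))
                              (sym (*-distribˡ-+ k (f zero) _))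

sumFin-lower : ∀ {n} c (f : Fin n → ℕ) → (∀ x → c ≤ f x) → n * c ≤ sumFin f
sumFin-lower {zero} c f bound = z≤n
sumFin-lower {suc n} c f bound =
  +-mono-≤ (bound zero) (sumFin-lower c (λ x → f (suc x)) (λ x → bound (suc x)))

indicator : Bool → ℕ
indicator true = 1
indicator false = 0

sumFin-indicator : ∀ {n} (S : Subset n) → sumFin (λ x → indicator (lookup S x)) ≡ ∣ S ∣
sumFin-indicator [] = refl
sumFin-indicator (true ∷ S) = cong suc (sumFin-indicator S)
sumFin-indicator (false ∷ S) = sumFin-indicator S

degree : ∀ {n} → Fin n → List (Subset n) → ℕ
degree x [] = 0
degree x (S ∷ F) = indicator (lookup S x) + degree x F

sumFin-degree : ∀ {n} (F : List (Subset n)) → sumFin (λ x → degree x F) ≡ sum (map ∣_∣ F)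
sumFin-degree {n} [] = sumFin-zero n
sumFin-degree (S ∷ F) = trans (sumFin-+ (λ x → indicator (lookup S x)) (λ x → degree x F))
                              (cong₂ _+_ (sumFin-indicator S) (sumFin-degree F))

sum-sizes : ∀ {n} d (F : List (Subset n)) → ((S : Subset n) → S LM.∈ F → ∣ S ∣ * d ≡ n) →
  sum (map ∣_∣ F) * d ≡ length F * n
sum-sizes d [] sizes = refl
sum-sizes {n} d (S ∷ F) sizes = begin
    (∣ S ∣ + sum (map ∣_∣ F)) * d     ≡⟨ *-distribʳ-+ d ∣ S ∣ _ ⟩
    ∣ S ∣ * d + sum (map ∣_∣ F) * d   ≡⟨ cong₂ _+_ (sizes S (here refl))
                                                  (sum-sizes d F (λ T T∈F → sizes T (there T∈F))) ⟩
    n + length F * n ∎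
  where open ≡-Reasoning

∣p∪q∣≤∣p∣+∣q∣ : ∀ {n} (p q : Subset n) → ∣ p ∪ q ∣ ≤ ∣ p ∣ + ∣ q ∣
∣p∪q∣≤∣p∣+∣q∣ [] [] = z≤n
∣p∪q∣≤∣p∣+∣q∣ (true ∷ p) (true ∷ q) = s≤s (≤-trans (∣p∪q∣≤∣p∣+∣q∣ p q) (+-monoʳ-≤ ∣ p ∣ (n≤1+n _)))
∣p∪q∣≤∣p∣+∣q∣ (true ∷ p) (false ∷ q) = s≤s (∣p∪q∣≤∣p∣+∣q∣ p q)
∣p∪q∣≤∣p∣+∣q∣ (false ∷ p) (true ∷ q) = ≤-trans (s≤s (∣p∪q∣≤∣p∣+∣q∣ p q)) (≤-reflexive (sym (+-suc ∣ p ∣ ∣ q ∣)))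
∣p∪q∣≤∣p∣+∣q∣ (false ∷ p) (false ∷ q) = ∣p∪q∣≤∣p∣+∣q∣ p q

star : ∀ {n} → Fin n → List (Subset n) → Subset n
star x [] = ⊥
star x (S ∷ F) = if lookup S x then S ∪ star x F else star x F

⊆-star : ∀ {n} x (F : List (Subset n)) (S : Subset n) → S LM.∈ F → x ∈ S → S ⊆ star x F
⊆-star x (T ∷ F) S (here refl) x∈S rewrite []=⇒lookup x∈S = p⊆p∪q (star x F)
⊆-star x (T ∷ F) S (there S∈F) x∈S with lookup T x
... | true = ⊆-trans (⊆-star x F S S∈F x∈S) (q⊆p∪q T (star x F))
... | false = ⊆-star x F S S∈F x∈S

-- The star is a union of degree-many members, so if |S| · d ≤ m for every member,
-- then |star x F| · d ≤ degree x F · m.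
star-size : ∀ {n} d m x (F : List (Subset n)) → ((S : Subset n) → S LM.∈ F → ∣ S ∣ * d ≤ m) →
  ∣ star x F ∣ * d ≤ degree x F * m
star-size {n} d m x [] sizes = ≤-reflexive (cong (_* d) (∣⊥∣≡0 n))
star-size d m x (S ∷ F) sizes with lookup S x
... | false = star-size d m x F (λ T T∈F → sizes T (there T∈F))
... | true = begin
    ∣ S ∪ star x F ∣ * d          ≤⟨ *-monoˡ-≤ d (∣p∪q∣≤∣p∣+∣q∣ S (star x F)) ⟩
    (∣ S ∣ + ∣ star x F ∣) * d     ≡⟨ *-distribʳ-+ d ∣ S ∣ _ ⟩
    ∣ S ∣ * d + ∣ star x F ∣ * d   ≤⟨ +-mono-≤ (sizes S (here refl))
                                              (star-size d m x F (λ T T∈F → sizes T (there T∈F))) ⟩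
    m + degree x F * m ∎
  where open ≤-Reasoning

extendToSize : ∀ {n} (V : Subset n) t → ∣ V ∣ ≤ t → t ≤ n → ∃[ A ] (V ⊆ A × ∣ A ∣ ≡ t)
extendToSize [] zero _ _ = [] , (λ ()) , refl
extendToSize (true ∷ V) (suc t) (s≤s V≤t) (s≤s t≤n) with extendToSize V t V≤t t≤n
... | A , V⊆A , ∣A∣≡t = true ∷ A , s⊆s V⊆A , cong suc ∣A∣≡t
extendToSize (false ∷ V) zero V≤t _ with extendToSize V zero V≤t z≤n
... | A , V⊆A , ∣A∣≡t = false ∷ A , out⊆ V⊆A , ∣A∣≡t
extendToSize (false ∷ V) (suc t) V≤t (s≤s t≤n) with ∣ V ∣ ≤? t
... | yes V≤t′ with extendToSize V t V≤t′ t≤n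
...   | A , V⊆A , ∣A∣≡t = true ∷ A , out⊆ V⊆A , cong suc ∣A∣≡t
extendToSize (false ∷ V) (suc t) V≤t (s≤s t≤n) | no V≰t with extendToSize V (suc t) V≤t (≤-trans (≰⇒> V≰t) (∣p∣≤n V))
...   | A , V⊆A , ∣A∣≡t = false ∷ A , out⊆ V⊆A , ∣A∣≡t

∈⇒∣p∣≥1 : ∀ {n} {x : Fin n} {S : Subset n} → x ∈ S → 1 ≤ ∣ S ∣
∈⇒∣p∣≥1 {x = x} {S} x∈S = subst (_≤ ∣ S ∣) (∣⁅x⁆∣≡1 x) (p⊆q⇒∣p∣≤∣q∣ ⁅x⁆⊆S)
  where
  ⁅x⁆⊆S : ⁅ x ⁆ ⊆ S
  ⁅x⁆⊆S y∈⁅x⁆ = subst (_∈ S) (sym (x∈⁅y⁆⇒x≡y x y∈⁅x⁆)) x∈S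

-- A subset of A that is balanced on A is empty: |S| = |S ∩ A| = |S|/2.
balanced-⊆⇒empty : ∀ {n} (S A : Subset n) → S ⊆ A → Balanced S A → ∣ S ∣ ≡ 0
balanced-⊆⇒empty S A S⊆A balanced = begin
    ∣ S ∣       ≡⟨ sym balanced ⟩
    2 * a       ≡⟨ cong (2 *_) a≡0 ⟩
    0 ∎
  where
  open ≡-Reasoning
  a = ∣ S ∩ A ∣
  -- 2a = |S| ≤ |S ∩ A| = a, hence a = 0
  a+a≤a+0 : a + (a + 0) ≤ a + 0
  a+a≤a+0 = subst₂ _≤_ (sym balanced) (sym (+-identityʳ a))
                   (p⊆q⇒∣p∣≤∣q∣ (λ y∈S → x∈p∩q⁺ (y∈S , S⊆A y∈S)))
  a≡0 : a ≡ 0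
  a≡0 = n≤0⇒n≡0 (≤-trans (m≤m+n a 0) (+-cancelˡ-≤ a (a + 0) 0 a+a≤a+0))

-- For each halving set A and point x, a Galvin family has a member through x balanced
-- on A: the block through x of the partition provided for A.
balancedMemberThrough : ∀ {n} d (F : List (Subset n)) → IsGalvin d F →
  (A : Subset n) → 2 * ∣ A ∣ ≡ n → (x : Fin n) → ∃[ S ] (S LM.∈ F × x ∈ S × Balanced S A)
balancedMemberThrough d F (_ , galvin) A halving x with galvin A halving
... | S , members , partition , balanced with partition x
...   | i , x∈Si , _ = S i , members i , x∈Si , balanced i

star-large : ∀ {n} d t (F : List (Subset n)) → IsGalvin d F → 2 * t ≡ n →
  (x : Fin n) → t ≤ ∣ star x F ∣
star-large d t F galvin 2t≡n x with t ≤? ∣ star x F ∣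
... | yes t≤star = t≤star
... | no t≰star with extendToSize (star x F) t (<⇒≤ (≰⇒> t≰star)) (subst (t ≤_) 2t≡n (m≤m+n t (t + 0)))
...   | A , star⊆A , ∣A∣≡t with balancedMemberThrough d F galvin A (trans (cong (2 *_) ∣A∣≡t) 2t≡n) x
...     | S , S∈F , x∈S , balanced =
  contradiction (balanced-⊆⇒empty S A (λ y∈S → star⊆A (⊆-star x F S S∈F x∈S y∈S)) balanced)
                (≢-sym (<⇒≢ (∈⇒∣p∣≥1 x∈S)))

degree-large : ∀ {n} d t .{{_ : NonZero n}} (F : List (Subset n)) → IsGalvin d F → 2 * t ≡ n →
  (x : Fin n) → d ≤ 2 * degree x F
degree-large {n} d t F galvin@(sizes , _) 2t≡n x = *-cancelʳ-≤ d (2 * degree x F) n (begin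
    d * n                     ≡⟨ cong (d *_) (sym 2t≡n) ⟩
    d * (2 * t)               ≡⟨ *-comm d (2 * t) ⟩
    2 * t * d                 ≤⟨ *-monoˡ-≤ d (*-monoʳ-≤ 2 (star-large d t F galvin 2t≡n x)) ⟩
    2 * ∣ star x F ∣ * d      ≡⟨ *-assoc 2 ∣ star x F ∣ d ⟩
    2 * (∣ star x F ∣ * d)    ≤⟨ *-monoʳ-≤ 2 (star-size d n x F (λ S S∈F → ≤-reflexive (sizes S S∈F))) ⟩
    2 * (degree x F * n)      ≡⟨ sym (*-assoc 2 (degree x F) n) ⟩
    2 * degree x F * n ∎)
  where open ≤-Reasoning

mainTheorem4 : (d n : ℕ) → .{{_ : NonZero d}} → .{{_ : NonZero n}} → (2 * d) ∣ n →
    (F : List (Subset n)) → Unique F → IsGalvin d F →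
    d * d ≤ 2 * length F
mainTheorem4 d n (divides q n≡q*2d) F _ galvin@(sizes , _) = *-cancelˡ-≤ n (begin
    n * (d * d)                          ≡⟨ sym (*-assoc n d d) ⟩
    n * d * d                            ≤⟨ *-monoˡ-≤ d (sumFin-lower d (λ x → 2 * degree x F)
                                              (degree-large d (q * d) F galvin 2t≡n)) ⟩
    sumFin (λ x → 2 * degree x F) * d    ≡⟨ cong (_* d) (sumFin-*ˡ 2 (λ x → degree x F)) ⟩
    2 * sumFin (λ x → degree x F) * d    ≡⟨ cong (λ s → 2 * s * d) (sumFin-degree F) ⟩
    2 * sum (map ∣_∣ F) * d              ≡⟨ *-assoc 2 (sum (map ∣_∣ F)) d ⟩
    2 * (sum (map ∣_∣ F) * d)            ≡⟨ cong (2 *_) (sum-sizes d F sizes) ⟩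
    2 * (length F * n)                   ≡⟨ solve 2 (λ l m → con 2 :* (l :* m) := m :* (con 2 :* l)) refl (length F) n ⟩
    n * (2 * length F) ∎)
  where
  open ≤-Reasoning
  open +-*-Solver
  -- n = q · 2d, so t = q · d is half of n
  2t≡n : 2 * (q * d) ≡ n
  2t≡n = trans (solve 2 (λ a b → con 2 :* (a :* b) := a :* (con 2 :* b)) refl q d) (sym n≡q*2d)
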